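{- For every constant $\delta > 0$, a uniformly random boolean function $f : \{ -1,1\}^n \to \{ -1,1\}$ satisfies \[ \sum_{S \subseteq [n]} \widehat{f}(S)^2 \log_2 \frac{1}{\widehat{f}(S)^2} \;\leq\; (2+\delta) \sum_{S \subseteq [n]} \widehat{f}(S)^2 |S| \] with high probability, i.e. with probability tending to $1$ as $n \to \infty$.
   Context: A uniformly random boolean function $f:\{ -1,1\}^n\to\{ -1,1\}$ is obtained by choosing the values $f(x)$, $x \in \{ -1,1\}^n$, independently and uniformly from $\{ -1,1\}$; equivalently each of the $2^{2^n}$ functions is chosen with probability $2^{ -2^n}$. For $S \subseteq [n]=\{1,\dots,n\}$, let $\chi_S(x)=\prod_{i\in S} x_i$ and let $\widehat{f}(S) = 2^{ -n}\sum_{x\in\{ -1,1\}^n} f(x)\chi_S(x)$ be the Fourier coefficient of $f$, so that $f=\sum_S \widehat{f}(S)\chi_S$. Terms with $\widehat{f}(S)=0$ in the sum $\sum_S \widehat{f}(S)^2\log_2(1/\widehat{f}(S)^2)$ (the Fourier entropy of $f$) are taken to be $0$. The quantity $\sum_S \widehat{f}(S)^2|S|$ is the total influence of $f$.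
   Formalization: The constant δ ranges over the positive rationals. -}

module Defs where

open import Data.Bool using (Bool; true; false; _∧_; _xor_; if_then_else_)
open import Data.Nat using (ℕ; zero; suc; _+_; _*_; _^_; _≤_; _≤?_)
open import Data.Integer as ℤ using (ℤ; ∣_∣; 1ℤ; -1ℤ; 0ℤ)
open import Data.List using (List; []; _∷_; [_]; map; concatMap; cartesianProduct; foldr; length; filter)
open import Data.Nat.ListAction using (sum; product)
open import Data.Vec using (Vec; []; _∷_)
open import Data.Product using (_×_; _,_)
open import Data.Rational using (ℚ; ↥_; ↧ₙ_)
open import Relation.Nullary using (Dec; ¬_; ¬?)

-- Points of the cube {-1,1}^n.  Bool encodes a sign: false ↦ +1, true ↦ -1.
-- The same type, read as an indicator vector, encodes subsets S ⊆ [n].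
allVecs : (n : ℕ) → List (Vec Bool n)
allVecs zero = [ [] ]
allVecs (suc n) = concatMap (λ b → map (b ∷_) (allVecs n)) (false ∷ true ∷ [])

sign : Bool → ℤ
sign false = 1ℤ
sign true  = -1ℤ

-- Boolean functions {-1,1}^n → {-1,1}, as full truth tables:
-- a function on n+1 variables is the pair of its restrictions to x₁ = +1 and x₁ = -1.
BoolFun : ℕ → Set
BoolFun zero = Bool
BoolFun (suc n) = BoolFun n × BoolFun n

eval : ∀ {n} → BoolFun n → Vec Bool n → Bool
eval {zero}  f         []      = f
eval {suc n} (f₀ , f₁) (b ∷ x) = eval (if b then f₁ else f₀) x

-- Every boolean function on n variables appears exactly once (2^(2^n) entries),
-- so the uniform distribution on this list is the uniformly random boolean function.
allFuns : (n : ℕ) → List (BoolFun n)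
allFuns zero = false ∷ true ∷ []
allFuns (suc n) = cartesianProduct (allFuns n) (allFuns n)

χ : ∀ {n} → Vec Bool n → Vec Bool n → ℤ
χ []      []      = 1ℤ
χ (s ∷ S) (b ∷ x) = (if s then sign b else 1ℤ) ℤ.* χ S x

card : ∀ {n} → Vec Bool n → ℕ
card []          = 0
card (true ∷ S)  = suc (card S)
card (false ∷ S) = card S

-- 2^n · f̂(S) = Σ_x f(x) χ_S(x)   (an integer)
fourierNum : ∀ {n} → BoolFun n → Vec Bool n → ℤ
fourierNum {n} f S = foldr ℤ._+_ 0ℤ (map (λ x → sign (eval f x) ℤ.* χ S x) (allVecs n))

-- 4^n · f̂(S)^2   (a natural number)
wt : ∀ {n} → BoolFun n → Vec Bool n → ℕ
wt f S = ∣ fourierNum f S ∣ ^ 2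

-- The event  Σ_S f̂(S)² log₂(1/f̂(S)²) ≤ (2+δ) Σ_S f̂(S)² |S|,  for δ = p/q, p = ↥δ, q = ↧δ.
-- With w_S = 4^n f̂(S)², multiplying by q·4^n and exponentiating base 2 (monotone), this is
--   ∏_S (4^n / w_S)^(q w_S) ≤ 2^((2q+p) Σ_S w_S |S|),
-- i.e. (terms with w_S = 0 contribute factor 1, matching the 0 log 0 = 0 convention)
--   2^(2 n q Σ_S w_S) ≤ 2^((2q+p) Σ_S w_S |S|) · ∏_S w_S^(q w_S).
EntropyBound : ℚ → ∀ n → BoolFun n → Set
EntropyBound δ n f =
  2 ^ (2 * n * q * sum (map w (allVecs n)))
    ≤ 2 ^ ((2 * q + p) * sum (map (λ S → w S * card S) (allVecs n)))
      * product (map (λ S → w S ^ (q * w S)) (allVecs n))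
  where
    p = ∣ ↥ δ ∣
    q = ↧ₙ δ
    w = wt f

entropyBound? : (δ : ℚ) → ∀ n → (f : BoolFun n) → Dec (EntropyBound δ n f)
entropyBound? δ n f = _ ≤? _

badCount : ℚ → ℕ → ℕ
badCount δ n = length (filter (λ f → ¬? (entropyBound? δ n f)) (allFuns n))

-- Write w_S = 4ⁿ f̂(S)². Parseval gives Σ_S w_S = 4ⁿ, and Σ_S w_S |S| is 2·2ⁿ times the edge
-- boundary of f. Comparing every w_S with t = 2^a through t^w ≤ w^w t^t bounds the Fourier entropy
-- by n + c + a/2^c when n = a + c, so the inequality holds as soon as the boundary is at least a
-- (4+δ)/(4+2δ) fraction of its mean n2ⁿ/4. For a uniformly random f the deviation of the boundary
-- from its mean splits, along the first coordinate, into the deviations of the two halves plus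
-- their correlation, and these parts are orthogonal; this gives variance n2ⁿ/8, and Chebyshev's
-- inequality shows that only a vanishing fraction of functions has a boundary that small.

module Submission where

open import Defs
open import Data.Bool using (Bool; true; false)
open import Data.List using (List; []; _∷_; map; foldr; length; _++_; cartesianProduct; filter)
open import Data.List.Properties using (length-++; length-map)
open import Data.Vec using (Vec; []; _∷_)
open import Data.Product using (_×_; _,_)
open import Function using (_∘_)
open import Relation.Binary.PropositionalEquality

module _ where
  open import Data.Nat

  length-cartesianProduct : {A B : Set} (xs : List A) (ys : List B) →
    length (cartesianProduct xs ys) ≡ length xs * length ys
  length-cartesianProduct []       ys = refl
  length-cartesianProduct (x ∷ xs) ys = begin
      length (map (x ,_) ys ++ cartesianProduct xs ys)
    ≡⟨ length-++ (map (x ,_) ys) ⟩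
      length (map (x ,_) ys) + length (cartesianProduct xs ys)
    ≡⟨ cong₂ _+_ (length-map (x ,_) ys) (length-cartesianProduct xs ys) ⟩
      length ys + length xs * length ys
    ∎
    where open ≡-Reasoning

  length-allVecs : ∀ n → length (allVecs n) ≡ 2 ^ n
  length-allVecs zero    = refl
  length-allVecs (suc n) = begin
      length (map (false ∷_) V ++ map (true ∷_) V ++ [])
    ≡⟨ length-++ (map (false ∷_) V) ⟩
      length (map (false ∷_) V) + length (map (true ∷_) V ++ [])
    ≡⟨ cong (length (map (false ∷_) V) +_) (length-++ (map (true ∷_) V)) ⟩
      length (map (false ∷_) V) + (length (map (true ∷_) V) + 0)
    ≡⟨ cong₂ (λ u v → u + (v + 0)) (length-map (false ∷_) V) (length-map (true ∷_) V) ⟩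
      length V + (length V + 0)
    ≡⟨ cong (λ u → u + (u + 0)) (length-allVecs n) ⟩
      2 ^ suc n
    ∎
    where
      open ≡-Reasoning
      V = allVecs n

  hamming : ∀ {n} → BoolFun n → BoolFun n → ℕ
  hamming {zero}  false false = 0
  hamming {zero}  false true  = 1
  hamming {zero}  true  false = 1
  hamming {zero}  true  true  = 0
  hamming {suc n} (a₀ , a₁) (b₀ , b₁) = hamming a₀ b₀ + hamming a₁ b₁

  hamming-comm : ∀ {n} (a b : BoolFun n) → hamming a b ≡ hamming b a
  hamming-comm {zero}  false false = refl
  hamming-comm {zero}  false true  = refl
  hamming-comm {zero}  true  false = refl
  hamming-comm {zero}  true  true  = refl
  hamming-comm {suc n} (a₀ , a₁) (b₀ , b₁) = cong₂ _+_ (hamming-comm a₀ b₀) (hamming-comm a₁ b₁)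

  -- The number of edges {x, y} of the cube with f x ≠ f y.
  boundary : ∀ {n} → BoolFun n → ℕ
  boundary {zero}  _         = 0
  boundary {suc n} (f₀ , f₁) = boundary f₀ + boundary f₁ + hamming f₀ f₁

module _ where
  open import Data.Nat as ℕ using (ℕ; zero; suc)
  open import Data.Integer hiding (suc; sign)
  open import Data.Integer.Properties
  open import Data.Integer.Tactic.RingSolver using (solve-∀)

  pos-^ : ∀ m n → + (m ℕ.^ n) ≡ (+ m) ^ n
  pos-^ m zero    = refl
  pos-^ m (suc n) = trans (pos-* m (m ℕ.^ n)) (cong (+ m *_) (pos-^ m n))

  infix 8 _²
  _² : ℤ → ℤ
  x ² = x * x

  infix 5 ∑
  ∑ : {A : Set} → List A → (A → ℤ) → ℤ
  ∑ xs h = foldr _+_ 0ℤ (map h xs)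

  syntax ∑ xs (λ x → e) = ∑[ x ∈ xs ] e

  module _ {A : Set} where

    ∑-++ : (xs ys : List A) (h : A → ℤ) → ∑ (xs ++ ys) h ≡ ∑ xs h + ∑ ys h
    ∑-++ []       ys h = sym (+-identityˡ _)
    ∑-++ (x ∷ xs) ys h = trans (cong (_+_ (h x)) (∑-++ xs ys h)) (sym (+-assoc (h x) _ _))

    ∑-cong : (xs : List A) {h h′ : A → ℤ} → (∀ x → h x ≡ h′ x) → ∑ xs h ≡ ∑ xs h′
    ∑-cong []       eq = refl
    ∑-cong (x ∷ xs) eq = cong₂ _+_ (eq x) (∑-cong xs eq)

    ∑-zero : (xs : List A) {h : A → ℤ} → (∀ x → h x ≡ 0ℤ) → ∑ xs h ≡ 0ℤ
    ∑-zero []       eq = refl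
    ∑-zero (x ∷ xs) eq = cong₂ _+_ (eq x) (∑-zero xs eq)

    ∑-+ : (xs : List A) (h h′ : A → ℤ) → (∑[ x ∈ xs ] (h x + h′ x)) ≡ ∑ xs h + ∑ xs h′
    ∑-+ []       h h′ = refl
    ∑-+ (x ∷ xs) h h′ = trans (cong (_+_ (h x + h′ x)) (∑-+ xs h h′)) (interchange (h x) (h′ x) _ _)
      where
        interchange : ∀ a b c d → a + b + (c + d) ≡ a + c + (b + d)
        interchange = solve-∀

    ∑-*ˡ : (xs : List A) (c : ℤ) (h : A → ℤ) → (∑[ x ∈ xs ] c * h x) ≡ c * ∑ xs h
    ∑-*ˡ []       c h = sym (*-zeroʳ c)
    ∑-*ˡ (x ∷ xs) c h = trans (cong (_+_ (c * h x)) (∑-*ˡ xs c h)) (sym (*-distribˡ-+ c (h x) _))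

    ∑-*ʳ : (xs : List A) (c : ℤ) (h : A → ℤ) → (∑[ x ∈ xs ] h x * c) ≡ ∑ xs h * c
    ∑-*ʳ xs c h = trans (∑-cong xs (λ x → *-comm (h x) c)) (trans (∑-*ˡ xs c h) (*-comm c _))

    ∑-const : (xs : List A) (c : ℤ) → ∑ xs (λ _ → c) ≡ + length xs * c
    ∑-const []       c = refl
    ∑-const (x ∷ xs) c = trans (cong (_+_ c) (∑-const xs c)) (distrib c (+ length xs))
      where
        distrib : ∀ c l → c + l * c ≡ (1ℤ + l) * c
        distrib = solve-∀

    ∑-map : {B : Set} (g : B → A) (xs : List B) (h : A → ℤ) → ∑ (map g xs) h ≡ ∑ xs (h ∘ g)
    ∑-map g []       h = refl
    ∑-map g (x ∷ xs) h = cong (_+_ (h (g x))) (∑-map g xs h)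

  ∑-allVecs-suc : ∀ n (h : Vec Bool (suc n) → ℤ) →
    ∑ (allVecs (suc n)) h ≡ ∑ (allVecs n) (h ∘ (false ∷_)) + ∑ (allVecs n) (h ∘ (true ∷_))
  ∑-allVecs-suc n h = begin
      ∑ (map (false ∷_) V ++ map (true ∷_) V ++ []) h
    ≡⟨ ∑-++ (map (false ∷_) V) _ h ⟩
      ∑ (map (false ∷_) V) h + ∑ (map (true ∷_) V ++ []) h
    ≡⟨ cong (_+_ (∑ (map (false ∷_) V) h)) (trans (∑-++ (map (true ∷_) V) [] h) (+-identityʳ _)) ⟩
      ∑ (map (false ∷_) V) h + ∑ (map (true ∷_) V) h
    ≡⟨ cong₂ _+_ (∑-map (false ∷_) V h) (∑-map (true ∷_) V h) ⟩
      ∑ V (h ∘ (false ∷_)) + ∑ V (h ∘ (true ∷_))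
    ∎
    where
      open ≡-Reasoning
      V = allVecs n

  module _ {A B : Set} (xs : List A) (ys : List B) where

    ∑-swap : (h : A → B → ℤ) → (∑[ a ∈ xs ] ∑[ b ∈ ys ] h a b) ≡ (∑[ b ∈ ys ] ∑[ a ∈ xs ] h a b)
    ∑-swap h = helper xs
      where
        helper : (as : List A) → (∑[ a ∈ as ] ∑[ b ∈ ys ] h a b) ≡ (∑[ b ∈ ys ] ∑[ a ∈ as ] h a b)
        helper []       = sym (∑-zero ys (λ _ → refl))
        helper (a ∷ as) = trans (cong (_+_ (∑ ys (h a))) (helper as))
                                (sym (∑-+ ys (h a) (λ b → ∑[ a′ ∈ as ] h a′ b)))

    ∑-cartesianProduct : (h : A × B → ℤ) →
      ∑ (cartesianProduct xs ys) h ≡ (∑[ a ∈ xs ] ∑[ b ∈ ys ] h (a , b))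
    ∑-cartesianProduct h = helper xs
      where
        helper : (as : List A) → ∑ (cartesianProduct as ys) h ≡ (∑[ a ∈ as ] ∑[ b ∈ ys ] h (a , b))
        helper []       = refl
        helper (a ∷ as) = trans (∑-++ (map (a ,_) ys) _ h) (cong₂ _+_ (∑-map (a ,_) ys h) (helper as))

    ∑∑-+ : (h k : A → B → ℤ) →
      (∑[ a ∈ xs ] ∑[ b ∈ ys ] (h a b + k a b))
        ≡ (∑[ a ∈ xs ] ∑[ b ∈ ys ] h a b) + (∑[ a ∈ xs ] ∑[ b ∈ ys ] k a b)
    ∑∑-+ h k = trans (∑-cong xs (λ a → ∑-+ ys (h a) (k a))) (∑-+ xs _ _)

    ∑∑-separable : (u : A → ℤ) (v : B → ℤ) →
      (∑[ a ∈ xs ] ∑[ b ∈ ys ] (u a + v b)) ≡ + length ys * ∑ xs u + + length xs * ∑ ys v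
    ∑∑-separable u v = trans (∑∑-+ (λ a _ → u a) (λ _ b → v b))
      (cong₂ _+_ (trans (∑-cong xs (λ a → ∑-const ys (u a))) (∑-*ˡ xs (+ length ys) u))
                 (∑-const xs (∑ ys v)))

    ∑∑-product : (u : A → ℤ) (v : B → ℤ) → (∑[ a ∈ xs ] ∑[ b ∈ ys ] u a * v b) ≡ ∑ xs u * ∑ ys v
    ∑∑-product u v = trans (∑-cong xs (λ a → ∑-*ˡ ys (u a) v)) (∑-*ʳ xs (∑ ys v) u)

    ∑∑-separable-² : (u : A → ℤ) (v : B → ℤ) →
      (∑[ a ∈ xs ] ∑[ b ∈ ys ] (u a + v b) ²)
        ≡ + length ys * (∑[ a ∈ xs ] u a ²) + + length xs * (∑[ b ∈ ys ] v b ²) + + 2 * ∑ xs u * ∑ ys v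
    ∑∑-separable-² u v = begin
        (∑[ a ∈ xs ] ∑[ b ∈ ys ] (u a + v b) ²)
      ≡⟨ ∑-cong xs (λ a → ∑-cong ys (λ b → square-+ (u a) (v b))) ⟩
        (∑[ a ∈ xs ] ∑[ b ∈ ys ] ((u a ² + v b ²) + (+ 2 * u a) * v b))
      ≡⟨ ∑∑-+ _ _ ⟩
        (∑[ a ∈ xs ] ∑[ b ∈ ys ] (u a ² + v b ²)) + (∑[ a ∈ xs ] ∑[ b ∈ ys ] (+ 2 * u a) * v b)
      ≡⟨ cong₂ _+_ (∑∑-separable _ _) (trans (∑∑-product _ v) (cong (_* ∑ ys v) (∑-*ˡ xs (+ 2) u))) ⟩
        + length ys * (∑[ a ∈ xs ] u a ²) + + length xs * (∑[ b ∈ ys ] v b ²) + + 2 * ∑ xs u * ∑ ys v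
      ∎
      where
        open ≡-Reasoning
        square-+ : ∀ x y → (x + y) * (x + y) ≡ (x * x + y * y) + (+ 2 * x) * y
        square-+ = solve-∀

    ∑∑-orthogonal-² : (u : A → ℤ) (v : B → ℤ) (z : A → B → ℤ) →
      (∀ a → ∑ ys (z a) ≡ 0ℤ) → (∀ b → (∑[ a ∈ xs ] z a b) ≡ 0ℤ) →
      (∑[ a ∈ xs ] ∑[ b ∈ ys ] (u a + v b + z a b) ²)
        ≡ (∑[ a ∈ xs ] ∑[ b ∈ ys ] (u a + v b) ²) + (∑[ a ∈ xs ] ∑[ b ∈ ys ] z a b ²)
    ∑∑-orthogonal-² u v z rows cols = begin
        (∑[ a ∈ xs ] ∑[ b ∈ ys ] (u a + v b + z a b) ²)
      ≡⟨ ∑-cong xs (λ a → ∑-cong ys (λ b → square-+ (u a) (v b) (z a b))) ⟩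
        (∑[ a ∈ xs ] ∑[ b ∈ ys ] (s² a b + z² a b + uz a b + vz a b))
      ≡⟨ ∑∑-+ (λ a b → s² a b + z² a b + uz a b) vz ⟩
        (∑[ a ∈ xs ] ∑[ b ∈ ys ] (s² a b + z² a b + uz a b)) + ∑∑ vz
      ≡⟨ cong₂ _+_ (∑∑-+ (λ a b → s² a b + z² a b) uz) vzTerm ⟩
        (∑[ a ∈ xs ] ∑[ b ∈ ys ] (s² a b + z² a b)) + ∑∑ uz + 0ℤ
      ≡⟨ trans (+-identityʳ _) (cong₂ _+_ (∑∑-+ s² z²) uzTerm) ⟩
        ∑∑ s² + ∑∑ z² + 0ℤ
      ≡⟨ +-identityʳ _ ⟩
        ∑∑ s² + ∑∑ z²
      ∎
      where
        open ≡-Reasoning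
        square-+ : ∀ x y w → (x + y + w) * (x + y + w)
                           ≡ (((x + y) * (x + y) + w * w) + (+ 2 * x) * w) + (+ 2 * y) * w
        square-+ = solve-∀
        s² z² uz vz : A → B → ℤ
        s² a b = (u a + v b) ²
        z² a b = z a b ²
        uz a b = (+ 2 * u a) * z a b
        vz a b = (+ 2 * v b) * z a b
        ∑∑ : (A → B → ℤ) → ℤ
        ∑∑ h = ∑[ a ∈ xs ] ∑[ b ∈ ys ] h a b
        uzTerm : ∑∑ uz ≡ 0ℤ
        uzTerm = ∑-zero xs (λ a → trans (∑-*ˡ ys (+ 2 * u a) (z a))
                                        (trans (cong (+ 2 * u a *_) (rows a)) (*-zeroʳ (+ 2 * u a))))
        vzTerm : ∑∑ vz ≡ 0ℤ
        vzTerm = trans (∑-swap vz)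
                       (∑-zero ys (λ b → trans (∑-*ˡ xs (+ 2 * v b) (λ a → z a b))
                                               (trans (cong (+ 2 * v b *_) (cols b)) (*-zeroʳ (+ 2 * v b)))))

  -- The Walsh–Hadamard transform

  walsh : ∀ {n} → (Vec Bool n → ℤ) → Vec Bool n → ℤ
  walsh {n} g S = ∑[ x ∈ allVecs n ] g x * χ S x

  module _ {n : ℕ} (g : Vec Bool (suc n) → ℤ) where

    walsh-false : ∀ S → walsh g (false ∷ S) ≡ walsh (g ∘ (false ∷_)) S + walsh (g ∘ (true ∷_)) S
    walsh-false S = trans (∑-allVecs-suc n _)
      (cong₂ _+_ (∑-cong (allVecs n) (λ x → cong (g (false ∷ x) *_) (*-identityˡ (χ S x))))
                 (∑-cong (allVecs n) (λ x → cong (g (true ∷ x) *_) (*-identityˡ (χ S x)))))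

    walsh-true : ∀ S → walsh g (true ∷ S) ≡ walsh (g ∘ (false ∷_)) S - walsh (g ∘ (true ∷_)) S
    walsh-true S = trans (∑-allVecs-suc n _)
      (cong₂ _+_ (∑-cong (allVecs n) (λ x → cong (g (false ∷ x) *_) (*-identityˡ (χ S x))))
                 (trans (∑-cong (allVecs n) (λ x → sign-out (g (true ∷ x)) (χ S x)))
                        (trans (∑-*ˡ (allVecs n) -1ℤ _) (-1*i≡-i _))))
      where
        sign-out : ∀ a b → a * (-1ℤ * b) ≡ -1ℤ * (a * b)
        sign-out = solve-∀

  walsh-difference : ∀ {n} (g h : Vec Bool n → ℤ) S → walsh g S - walsh h S ≡ walsh (λ x → g x - h x) S
  walsh-difference {n} g h S = sym (begin
      (∑[ x ∈ allVecs n ] (g x - h x) * χ S x)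
    ≡⟨ ∑-cong (allVecs n) (λ x → distrib (g x) (h x) (χ S x)) ⟩
      (∑[ x ∈ allVecs n ] (g x * χ S x + -1ℤ * (h x * χ S x)))
    ≡⟨ ∑-+ (allVecs n) _ _ ⟩
      walsh g S + (∑[ x ∈ allVecs n ] -1ℤ * (h x * χ S x))
    ≡⟨ cong (_+_ (walsh g S)) (trans (∑-*ˡ (allVecs n) -1ℤ _) (-1*i≡-i _)) ⟩
      walsh g S - walsh h S
    ∎)
    where
      open ≡-Reasoning
      distrib : ∀ a b c → (a - b) * c ≡ a * c + -1ℤ * (b * c)
      distrib = solve-∀

  parseval : ∀ n (g : Vec Bool n → ℤ) →
    (∑[ S ∈ allVecs n ] walsh g S ²) ≡ (+ 2) ^ n * (∑[ x ∈ allVecs n ] g x ²)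
  parseval zero    g = base (g [])
    where
      base : ∀ a → (a * 1ℤ + 0ℤ) * (a * 1ℤ + 0ℤ) + 0ℤ ≡ 1ℤ * (a * a + 0ℤ)
      base = solve-∀
  parseval (suc n) g = begin
      (∑[ S ∈ allVecs (suc n) ] walsh g S ²)
    ≡⟨ ∑-allVecs-suc n _ ⟩
      (∑[ S ∈ V ] walsh g (false ∷ S) ²) + (∑[ S ∈ V ] walsh g (true ∷ S) ²)
    ≡⟨ cong₂ _+_ (∑-cong V (λ S → cong _² (walsh-false g S))) (∑-cong V (λ S → cong _² (walsh-true g S))) ⟩
      (∑[ S ∈ V ] (a S + b S) ²) + (∑[ S ∈ V ] (a S - b S) ²)
    ≡⟨ sym (∑-+ V _ _) ⟩
      (∑[ S ∈ V ] ((a S + b S) ² + (a S - b S) ²))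
    ≡⟨ ∑-cong V (λ S → parallelogram (a S) (b S)) ⟩
      (∑[ S ∈ V ] + 2 * (a S ² + b S ²))
    ≡⟨ trans (∑-*ˡ V (+ 2) _) (cong (+ 2 *_) (∑-+ V _ _)) ⟩
      + 2 * ((∑[ S ∈ V ] a S ²) + (∑[ S ∈ V ] b S ²))
    ≡⟨ cong (+ 2 *_) (cong₂ _+_ (parseval n g₀) (parseval n g₁)) ⟩
      + 2 * ((+ 2) ^ n * (∑[ x ∈ V ] g₀ x ²) + (+ 2) ^ n * (∑[ x ∈ V ] g₁ x ²))
    ≡⟨ regroup ((+ 2) ^ n) _ _ ⟩
      (+ 2) ^ suc n * ((∑[ x ∈ V ] g₀ x ²) + (∑[ x ∈ V ] g₁ x ²))
    ≡⟨ cong ((+ 2) ^ suc n *_) (sym (∑-allVecs-suc n _)) ⟩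
      (+ 2) ^ suc n * (∑[ x ∈ allVecs (suc n) ] g x ²)
    ∎
    where
      open ≡-Reasoning
      V = allVecs n
      g₀ = g ∘ (false ∷_)
      g₁ = g ∘ (true ∷_)
      a = walsh g₀
      b = walsh g₁
      parallelogram : ∀ x y → (x + y) * (x + y) + (x - y) * (x - y) ≡ + 2 * (x * x + y * y)
      parallelogram = solve-∀
      regroup : ∀ m x y → + 2 * (m * x + m * y) ≡ (+ 2 * m) * (x + y)
      regroup = solve-∀

  -- 4ⁿ times the total influence Σ_S ĝ(S)² |S|.
  totalInfluence : ∀ {n} → (Vec Bool n → ℤ) → ℤ
  totalInfluence {n} g = ∑[ S ∈ allVecs n ] walsh g S ² * + card S

  totalInfluence-suc : ∀ n (g : Vec Bool (suc n) → ℤ) →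
    totalInfluence g ≡ + 2 * (totalInfluence (g ∘ (false ∷_)) + totalInfluence (g ∘ (true ∷_)))
                       + (+ 2) ^ n * (∑[ x ∈ allVecs n ] (g (false ∷ x) - g (true ∷ x)) ²)
  totalInfluence-suc n g = begin
      totalInfluence g
    ≡⟨ ∑-allVecs-suc n _ ⟩
      (∑[ S ∈ V ] walsh g (false ∷ S) ² * + card S) + (∑[ S ∈ V ] walsh g (true ∷ S) ² * (1ℤ + + card S))
    ≡⟨ cong₂ _+_ (∑-cong V (λ S → cong (λ w → w ² * + card S) (walsh-false g S)))
                 (∑-cong V (λ S → cong (λ w → w ² * (1ℤ + + card S)) (walsh-true g S))) ⟩
      (∑[ S ∈ V ] (a S + b S) ² * + card S) + (∑[ S ∈ V ] (a S - b S) ² * (1ℤ + + card S))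
    ≡⟨ sym (∑-+ V _ _) ⟩
      (∑[ S ∈ V ] ((a S + b S) ² * + card S + (a S - b S) ² * (1ℤ + + card S)))
    ≡⟨ ∑-cong V (λ S → regroup (a S) (b S) (+ card S)) ⟩
      (∑[ S ∈ V ] (+ 2 * (a S ² * + card S + b S ² * + card S) + (a S - b S) ²))
    ≡⟨ ∑-+ V _ _ ⟩
      (∑[ S ∈ V ] + 2 * (a S ² * + card S + b S ² * + card S)) + (∑[ S ∈ V ] (a S - b S) ²)
    ≡⟨ cong₂ _+_ (trans (∑-*ˡ V (+ 2) _) (cong (+ 2 *_) (∑-+ V _ _)))
                 (trans (∑-cong V (λ S → cong _² (walsh-difference g₀ g₁ S))) (parseval n (λ x → g₀ x - g₁ x))) ⟩
      + 2 * (totalInfluence g₀ + totalInfluence g₁) + (+ 2) ^ n * (∑[ x ∈ V ] (g₀ x - g₁ x) ²)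
    ∎
    where
      open ≡-Reasoning
      V = allVecs n
      g₀ = g ∘ (false ∷_)
      g₁ = g ∘ (true ∷_)
      a = walsh g₀
      b = walsh g₁
      regroup : ∀ x y c → (x + y) * (x + y) * c + (x - y) * (x - y) * (1ℤ + c)
                         ≡ + 2 * (x * x * c + y * y * c) + (x - y) * (x - y)
      regroup = solve-∀

  ⟦_⟧ : ∀ {n} → BoolFun n → Vec Bool n → ℤ
  ⟦ f ⟧ x = sign (eval f x)

  ∑-⟦⟧² : ∀ {n} (f : BoolFun n) → (∑[ x ∈ allVecs n ] ⟦ f ⟧ x ²) ≡ (+ 2) ^ n
  ∑-⟦⟧² {n} f = begin
      (∑[ x ∈ allVecs n ] ⟦ f ⟧ x ²)
    ≡⟨ ∑-cong (allVecs n) (λ x → sign-² (eval f x)) ⟩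
      ∑ (allVecs n) (λ _ → 1ℤ)
    ≡⟨ trans (∑-const (allVecs n) 1ℤ) (*-identityʳ _) ⟩
      + length (allVecs n)
    ≡⟨ trans (cong +_ (length-allVecs n)) (pos-^ 2 n) ⟩
      (+ 2) ^ n
    ∎
    where
      open ≡-Reasoning
      sign-² : ∀ b → sign b ² ≡ 1ℤ
      sign-² false = refl
      sign-² true  = refl

  ∑-⟦⟧-difference² : ∀ {n} (f g : BoolFun n) →
    (∑[ x ∈ allVecs n ] (⟦ f ⟧ x - ⟦ g ⟧ x) ²) ≡ + 4 * + hamming f g
  ∑-⟦⟧-difference² {zero}  false false = refl
  ∑-⟦⟧-difference² {zero}  false true  = refl
  ∑-⟦⟧-difference² {zero}  true  false = refl
  ∑-⟦⟧-difference² {zero}  true  true  = refl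
  ∑-⟦⟧-difference² {suc n} (f₀ , f₁) (g₀ , g₁) = begin
      (∑[ x ∈ allVecs (suc n) ] (⟦ f₀ , f₁ ⟧ x - ⟦ g₀ , g₁ ⟧ x) ²)
    ≡⟨ ∑-allVecs-suc n _ ⟩
      (∑[ x ∈ allVecs n ] (⟦ f₀ ⟧ x - ⟦ g₀ ⟧ x) ²) + (∑[ x ∈ allVecs n ] (⟦ f₁ ⟧ x - ⟦ g₁ ⟧ x) ²)
    ≡⟨ cong₂ _+_ (∑-⟦⟧-difference² f₀ g₀) (∑-⟦⟧-difference² f₁ g₁) ⟩
      + 4 * + hamming f₀ g₀ + + 4 * + hamming f₁ g₁
    ≡⟨ sym (trans (cong (+ 4 *_) (pos-+ (hamming f₀ g₀) (hamming f₁ g₁))) (*-distribˡ-+ (+ 4) (+ hamming f₀ g₀) (+ hamming f₁ g₁))) ⟩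
      + 4 * + hamming (f₀ , f₁) (g₀ , g₁)
    ∎
    where open ≡-Reasoning

  parseval-⟦⟧ : ∀ {n} (f : BoolFun n) → (∑[ S ∈ allVecs n ] walsh ⟦ f ⟧ S ²) ≡ (+ 2) ^ n * (+ 2) ^ n
  parseval-⟦⟧ {n} f = trans (parseval n ⟦ f ⟧) (cong ((+ 2) ^ n *_) (∑-⟦⟧² f))

  totalInfluence-⟦⟧ : ∀ {n} (f : BoolFun n) → totalInfluence ⟦ f ⟧ ≡ + 2 * (+ 2) ^ n * + boundary f
  totalInfluence-⟦⟧ {zero}  f = base (⟦ f ⟧ [])
    where
      base : ∀ a → (a * 1ℤ + 0ℤ) * (a * 1ℤ + 0ℤ) * 0ℤ + 0ℤ ≡ + 2 * 1ℤ * 0ℤ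
      base = solve-∀
  totalInfluence-⟦⟧ {suc n} (f₀ , f₁) = begin
      totalInfluence ⟦ f₀ , f₁ ⟧
    ≡⟨ totalInfluence-suc n ⟦ f₀ , f₁ ⟧ ⟩
      + 2 * (totalInfluence ⟦ f₀ ⟧ + totalInfluence ⟦ f₁ ⟧)
        + (+ 2) ^ n * (∑[ x ∈ allVecs n ] (⟦ f₀ ⟧ x - ⟦ f₁ ⟧ x) ²)
    ≡⟨ cong₂ _+_ (cong (+ 2 *_) (cong₂ _+_ (totalInfluence-⟦⟧ f₀) (totalInfluence-⟦⟧ f₁)))
                 (cong ((+ 2) ^ n *_) (∑-⟦⟧-difference² f₀ f₁)) ⟩
      + 2 * (+ 2 * m * + boundary f₀ + + 2 * m * + boundary f₁) + m * (+ 4 * + hamming f₀ f₁)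
    ≡⟨ regroup m (+ boundary f₀) (+ boundary f₁) (+ hamming f₀ f₁) ⟩
      + 2 * (+ 2 * m) * (+ boundary f₀ + + boundary f₁ + + hamming f₀ f₁)
    ≡⟨ cong (+ 2 * (+ 2 * m) *_) (sym (trans (pos-+ (boundary f₀ ℕ.+ boundary f₁) (hamming f₀ f₁))
                                             (cong (_+ + hamming f₀ f₁) (pos-+ (boundary f₀) (boundary f₁))))) ⟩
      + 2 * (+ 2) ^ suc n * + boundary (f₀ , f₁)
    ∎
    where
      open ≡-Reasoning
      m = (+ 2) ^ n
      regroup : ∀ m x y z → + 2 * (+ 2 * m * x + + 2 * m * y) + m * (+ 4 * z) ≡ + 2 * (+ 2 * m) * (x + y + z)
      regroup = solve-∀

  -- Moments of the boundary of a random function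

  length-allFuns-suc : ∀ n → + length (allFuns (suc n)) ≡ + length (allFuns n) * + length (allFuns n)
  length-allFuns-suc n = trans (cong +_ (length-cartesianProduct (allFuns n) (allFuns n)))
                               (pos-* (length (allFuns n)) (length (allFuns n)))

  -- Equals Σ_x ⟦ a ⟧ x * ⟦ b ⟧ x: agreements minus disagreements.
  correlation : ∀ n → BoolFun n → BoolFun n → ℤ
  correlation n a b = (+ 2) ^ n - + 2 * + hamming a b

  correlation-suc : ∀ n a₀ a₁ b₀ b₁ →
    correlation (suc n) (a₀ , a₁) (b₀ , b₁) ≡ correlation n a₀ b₀ + correlation n a₁ b₁
  correlation-suc n a₀ a₁ b₀ b₁ =
    trans (cong (λ h → (+ 2) ^ suc n - + 2 * h) (pos-+ (hamming a₀ b₀) (hamming a₁ b₁)))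
          (split ((+ 2) ^ n) (+ hamming a₀ b₀) (+ hamming a₁ b₁))
    where
      split : ∀ m x y → + 2 * m - + 2 * (x + y) ≡ (m - + 2 * x) + (m - + 2 * y)
      split = solve-∀

  correlation-comm : ∀ n a b → correlation n a b ≡ correlation n b a
  correlation-comm n a b = cong (λ h → (+ 2) ^ n - + 2 * + h) (hamming-comm a b)

  ∑-correlation : ∀ n a → ∑ (allFuns n) (correlation n a) ≡ 0ℤ
  ∑-correlation zero    false = refl
  ∑-correlation zero    true  = refl
  ∑-correlation (suc n) (a₀ , a₁) = begin
      ∑ (allFuns (suc n)) (correlation (suc n) (a₀ , a₁))
    ≡⟨ ∑-cartesianProduct L L _ ⟩
      (∑[ b₀ ∈ L ] ∑[ b₁ ∈ L ] correlation (suc n) (a₀ , a₁) (b₀ , b₁))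
    ≡⟨ ∑-cong L (λ b₀ → ∑-cong L (λ b₁ → correlation-suc n a₀ a₁ b₀ b₁)) ⟩
      (∑[ b₀ ∈ L ] ∑[ b₁ ∈ L ] (correlation n a₀ b₀ + correlation n a₁ b₁))
    ≡⟨ ∑∑-separable L L (correlation n a₀) (correlation n a₁) ⟩
      + length L * ∑ L (correlation n a₀) + + length L * ∑ L (correlation n a₁)
    ≡⟨ cong₂ (λ u v → + length L * u + + length L * v) (∑-correlation n a₀) (∑-correlation n a₁) ⟩
      + length L * 0ℤ + + length L * 0ℤ
    ≡⟨ cong₂ _+_ (*-zeroʳ (+ length L)) (*-zeroʳ (+ length L)) ⟩
      0ℤ
    ∎
    where
      open ≡-Reasoning
      L = allFuns n

  ∑-correlation² : ∀ n a → (∑[ b ∈ allFuns n ] correlation n a b ²) ≡ (+ 2) ^ n * + length (allFuns n)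
  ∑-correlation² zero    false = refl
  ∑-correlation² zero    true  = refl
  ∑-correlation² (suc n) (a₀ , a₁) = begin
      (∑[ b ∈ allFuns (suc n) ] correlation (suc n) (a₀ , a₁) b ²)
    ≡⟨ ∑-cartesianProduct L L _ ⟩
      (∑[ b₀ ∈ L ] ∑[ b₁ ∈ L ] correlation (suc n) (a₀ , a₁) (b₀ , b₁) ²)
    ≡⟨ ∑-cong L (λ b₀ → ∑-cong L (λ b₁ → cong _² (correlation-suc n a₀ a₁ b₀ b₁))) ⟩
      (∑[ b₀ ∈ L ] ∑[ b₁ ∈ L ] (correlation n a₀ b₀ + correlation n a₁ b₁) ²)
    ≡⟨ ∑∑-separable-² L L (correlation n a₀) (correlation n a₁) ⟩
      N * (∑[ b ∈ L ] correlation n a₀ b ²) + N * (∑[ b ∈ L ] correlation n a₁ b ²)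
        + + 2 * ∑ L (correlation n a₀) * ∑ L (correlation n a₁)
    ≡⟨ cong₂ _+_ (cong₂ (λ u v → N * u + N * v) (∑-correlation² n a₀) (∑-correlation² n a₁))
                 (cong₂ (λ u v → + 2 * u * v) (∑-correlation n a₀) (∑-correlation n a₁)) ⟩
      N * (m * N) + N * (m * N) + + 2 * 0ℤ * 0ℤ
    ≡⟨ regroup N m ⟩
      + 2 * m * (N * N)
    ≡⟨ cong ((+ 2) ^ suc n *_) (sym (length-allFuns-suc n)) ⟩
      (+ 2) ^ suc n * + length (allFuns (suc n))
    ∎
    where
      open ≡-Reasoning
      L = allFuns n
      N = + length L
      m = (+ 2) ^ n
      regroup : ∀ N m → N * (m * N) + N * (m * N) + + 2 * 0ℤ * 0ℤ ≡ + 2 * m * (N * N)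
      regroup = solve-∀

  -- 4 (n 2ⁿ / 4 − boundary f), where n 2ⁿ / 4 is the mean boundary of a uniformly random f.
  deviation : ∀ n → BoolFun n → ℤ
  deviation n f = + n * (+ 2) ^ n - + 4 * + boundary f

  deviation-suc : ∀ n f₀ f₁ →
    deviation (suc n) (f₀ , f₁) ≡ deviation n f₀ + deviation n f₁ + + 2 * correlation n f₀ f₁
  deviation-suc n f₀ f₁ =
    trans (cong (λ b → + suc n * (+ 2) ^ suc n - + 4 * b)
                (trans (pos-+ (boundary f₀ ℕ.+ boundary f₁) (hamming f₀ f₁))
                       (cong (_+ + hamming f₀ f₁) (pos-+ (boundary f₀) (boundary f₁)))))
          (regroup (+ n) ((+ 2) ^ n) (+ boundary f₀) (+ boundary f₁) (+ hamming f₀ f₁))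
    where
      regroup : ∀ n m x y d → (1ℤ + n) * (+ 2 * m) - + 4 * (x + y + d)
                            ≡ (n * m - + 4 * x) + (n * m - + 4 * y) + + 2 * (m - + 2 * d)
      regroup = solve-∀

  ∑-deviation : ∀ n → ∑ (allFuns n) (deviation n) ≡ 0ℤ
  ∑-deviation zero    = refl
  ∑-deviation (suc n) = begin
      ∑ (allFuns (suc n)) (deviation (suc n))
    ≡⟨ ∑-cartesianProduct L L _ ⟩
      (∑[ f₀ ∈ L ] ∑[ f₁ ∈ L ] deviation (suc n) (f₀ , f₁))
    ≡⟨ ∑-cong L (λ f₀ → ∑-cong L (λ f₁ → deviation-suc n f₀ f₁)) ⟩
      (∑[ f₀ ∈ L ] ∑[ f₁ ∈ L ] (deviation n f₀ + deviation n f₁ + + 2 * correlation n f₀ f₁))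
    ≡⟨ ∑∑-+ L L _ _ ⟩
      (∑[ f₀ ∈ L ] ∑[ f₁ ∈ L ] (deviation n f₀ + deviation n f₁))
        + (∑[ f₀ ∈ L ] ∑[ f₁ ∈ L ] + 2 * correlation n f₀ f₁)
    ≡⟨ cong₂ _+_ (∑∑-separable L L (deviation n) (deviation n)) correlationTerm ⟩
      N * ∑ L (deviation n) + N * ∑ L (deviation n) + 0ℤ
    ≡⟨ cong (λ d → N * d + N * d + 0ℤ) (∑-deviation n) ⟩
      N * 0ℤ + N * 0ℤ + 0ℤ
    ≡⟨ vanish N ⟩
      0ℤ
    ∎
    where
      open ≡-Reasoning
      L = allFuns n
      N = + length L
      vanish : ∀ N → N * 0ℤ + N * 0ℤ + 0ℤ ≡ 0ℤ
      vanish = solve-∀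
      correlationTerm : (∑[ f₀ ∈ L ] ∑[ f₁ ∈ L ] + 2 * correlation n f₀ f₁) ≡ 0ℤ
      correlationTerm = ∑-zero L (λ f₀ → trans (∑-*ˡ L (+ 2) (correlation n f₀))
                                               (cong (+ 2 *_) (∑-correlation n f₀)))

  ∑-deviation² : ∀ n → (∑[ f ∈ allFuns n ] deviation n f ²) ≡ + 2 * + length (allFuns n) * + n * (+ 2) ^ n
  ∑-deviation² zero    = refl
  ∑-deviation² (suc n) = begin
      (∑[ f ∈ allFuns (suc n) ] deviation (suc n) f ²)
    ≡⟨ ∑-cartesianProduct L L _ ⟩
      (∑[ f₀ ∈ L ] ∑[ f₁ ∈ L ] deviation (suc n) (f₀ , f₁) ²)
    ≡⟨ ∑-cong L (λ f₀ → ∑-cong L (λ f₁ → cong _² (deviation-suc n f₀ f₁))) ⟩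
      (∑[ f₀ ∈ L ] ∑[ f₁ ∈ L ] (deviation n f₀ + deviation n f₁ + c f₀ f₁) ²)
    ≡⟨ ∑∑-orthogonal-² L L (deviation n) (deviation n) c rows cols ⟩
      (∑[ f₀ ∈ L ] ∑[ f₁ ∈ L ] (deviation n f₀ + deviation n f₁) ²) + (∑[ f₀ ∈ L ] ∑[ f₁ ∈ L ] c f₀ f₁ ²)
    ≡⟨ cong₂ _+_ (∑∑-separable-² L L (deviation n) (deviation n)) correlationTerm ⟩
      N * D² + N * D² + + 2 * D * D + N * (+ 4 * (m * N))
    ≡⟨ cong₂ (λ d² d → N * d² + N * d² + + 2 * d * d + N * (+ 4 * (m * N))) (∑-deviation² n) (∑-deviation n) ⟩
      N * (+ 2 * N * + n * m) + N * (+ 2 * N * + n * m) + + 2 * 0ℤ * 0ℤ + N * (+ 4 * (m * N))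
    ≡⟨ regroup N (+ n) m ⟩
      + 2 * (N * N) * (1ℤ + + n) * (+ 2 * m)
    ≡⟨ cong (λ N′ → + 2 * N′ * + suc n * (+ 2) ^ suc n) (sym (length-allFuns-suc n)) ⟩
      + 2 * + length (allFuns (suc n)) * + suc n * (+ 2) ^ suc n
    ∎
    where
      open ≡-Reasoning
      L = allFuns n
      N = + length L
      m = (+ 2) ^ n
      D = ∑ L (deviation n)
      D² = ∑[ f ∈ L ] deviation n f ²
      c : BoolFun n → BoolFun n → ℤ
      c f₀ f₁ = + 2 * correlation n f₀ f₁
      rows : ∀ f₀ → ∑ L (c f₀) ≡ 0ℤ
      rows f₀ = trans (∑-*ˡ L (+ 2) (correlation n f₀)) (cong (+ 2 *_) (∑-correlation n f₀))
      cols : ∀ f₁ → (∑[ f₀ ∈ L ] c f₀ f₁) ≡ 0ℤ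
      cols f₁ = trans (∑-cong L (λ f₀ → cong (+ 2 *_) (correlation-comm n f₀ f₁))) (rows f₁)
      correlationTerm : (∑[ f₀ ∈ L ] ∑[ f₁ ∈ L ] c f₀ f₁ ²) ≡ N * (+ 4 * (m * N))
      correlationTerm = trans (∑-cong L (λ f₀ → trans (∑-cong L (λ f₁ → square-*ˡ (correlation n f₀ f₁)))
                                                      (trans (∑-*ˡ L (+ 4) _) (cong (+ 4 *_) (∑-correlation² n f₀)))))
                              (∑-const L _)
        where
          square-*ˡ : ∀ x → (+ 2 * x) * (+ 2 * x) ≡ + 4 * (x * x)
          square-*ˡ = solve-∀
      regroup : ∀ N n m → N * (+ 2 * N * n * m) + N * (+ 2 * N * n * m) + + 2 * 0ℤ * 0ℤ + N * (+ 4 * (m * N))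
                        ≡ + 2 * (N * N) * (1ℤ + n) * (+ 2 * m)
      regroup = solve-∀

-- Entropy versus boundary

module _ where
  open import Data.Nat
  open import Data.Nat.Properties
  open import Data.Nat.ListAction using (sum; product)
  open import Data.Nat.Tactic.RingSolver using (solve-∀)
  open import Data.Integer as ℤ using (+_; -[1+_]; ∣_∣)
  import Data.Integer.Properties as ℤP
  import Data.Integer.Tactic.RingSolver as ℤSolver
  open import Data.Rational as ℚ using (0ℚ; mkℚ; ↥_; ↧ₙ_)
  open import Data.Empty using (⊥-elim)
  open import Relation.Nullary using (¬_; ¬?; yes; no)
  open import Relation.Unary using (Decidable)

  pos-sum : {A : Set} (xs : List A) (h : A → ℕ) → + sum (map h xs) ≡ ∑ xs (+_ ∘ h)
  pos-sum []       h = refl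
  pos-sum (x ∷ xs) h = trans (ℤP.pos-+ (h x) _) (cong (ℤ._+_ (+ h x)) (pos-sum xs h))

  pos-∣i∣*∣i∣ : ∀ i → + (∣ i ∣ * ∣ i ∣) ≡ i ²
  pos-∣i∣*∣i∣ (+ n)    = ℤP.pos-* n n
  pos-∣i∣*∣i∣ -[1+ n ] = refl

  pos-wt : ∀ {n} (f : BoolFun n) S → + wt f S ≡ walsh ⟦ f ⟧ S ²
  pos-wt f S = trans (cong (λ k → + (∣ fourierNum f S ∣ * k)) (*-identityʳ _)) (pos-∣i∣*∣i∣ (fourierNum f S))

  sum-wt : ∀ {n} (f : BoolFun n) → sum (map (wt f) (allVecs n)) ≡ 2 ^ n * 2 ^ n
  sum-wt {n} f = ℤP.+-injective (begin
      + sum (map (wt f) (allVecs n))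
    ≡⟨ pos-sum (allVecs n) (wt f) ⟩
      ∑ (allVecs n) (+_ ∘ wt f)
    ≡⟨ ∑-cong (allVecs n) (pos-wt f) ⟩
      (∑[ S ∈ allVecs n ] walsh ⟦ f ⟧ S ²)
    ≡⟨ parseval-⟦⟧ f ⟩
      (+ 2) ℤ.^ n ℤ.* (+ 2) ℤ.^ n
    ≡⟨ sym (trans (ℤP.pos-* (2 ^ n) (2 ^ n)) (cong₂ ℤ._*_ (pos-^ 2 n) (pos-^ 2 n))) ⟩
      + (2 ^ n * 2 ^ n)
    ∎)
    where open ≡-Reasoning

  sum-wt*card : ∀ {n} (f : BoolFun n) →
    sum (map (λ S → wt f S * card S) (allVecs n)) ≡ 2 * 2 ^ n * boundary f
  sum-wt*card {n} f = ℤP.+-injective (begin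
      + sum (map (λ S → wt f S * card S) (allVecs n))
    ≡⟨ pos-sum (allVecs n) _ ⟩
      (∑[ S ∈ allVecs n ] + (wt f S * card S))
    ≡⟨ ∑-cong (allVecs n) (λ S → trans (ℤP.pos-* (wt f S) (card S)) (cong (ℤ._* + card S) (pos-wt f S))) ⟩
      totalInfluence ⟦ f ⟧
    ≡⟨ totalInfluence-⟦⟧ f ⟩
      + 2 ℤ.* (+ 2) ℤ.^ n ℤ.* + boundary f
    ≡⟨ sym (trans (ℤP.pos-* (2 * 2 ^ n) (boundary f))
                  (cong (ℤ._* + boundary f) (trans (ℤP.pos-* 2 (2 ^ n)) (cong (+ 2 ℤ.*_) (pos-^ 2 n))))) ⟩
      + (2 * 2 ^ n * boundary f)
    ∎)
    where open ≡-Reasoning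

  t^qw≤w^qw*t^qt : ∀ q {t} w → 1 ≤ t → t ^ (q * w) ≤ w ^ (q * w) * t ^ (q * t)
  t^qw≤w^qw*t^qt q {t} w 1≤t with t ≤? w
  ... | yes t≤w = ≤-trans (^-monoˡ-≤ (q * w) t≤w) (m≤m*n (w ^ (q * w)) (t ^ (q * t)) {{t^k≢0}})
    where instance
      t^k≢0 : NonZero (t ^ (q * t))
      t^k≢0 = m^n≢0 t (q * t) {{>-nonZero 1≤t}}
  ... | no  t≰w = ≤-trans (^-monoʳ-≤ t {{>-nonZero 1≤t}} (*-monoʳ-≤ q (<⇒≤ (≰⇒> t≰w))))
                          (m≤n*m (t ^ (q * t)) (w ^ (q * w)) {{w^qw≢0 w}})
    where
      w^qw≢0 : ∀ w → NonZero (w ^ (q * w))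
      w^qw≢0 zero    rewrite *-zeroʳ q = _
      w^qw≢0 (suc w) = m^n≢0 (suc w) (q * suc w)

  crude-entropy-bound : {A : Set} (xs : List A) (w : A → ℕ) (q : ℕ) {t : ℕ} → 1 ≤ t →
    t ^ (q * sum (map w xs)) ≤ product (map (λ x → w x ^ (q * w x)) xs) * t ^ (q * t * length xs)
  crude-entropy-bound []       w q {t} _   rewrite *-zeroʳ q | *-zeroʳ (q * t) = ≤-refl
  crude-entropy-bound (x ∷ xs) w q {t} 1≤t = begin
      t ^ (q * (w x + sum (map w xs)))
    ≡⟨ cong (t ^_) (*-distribˡ-+ q (w x) _) ⟩
      t ^ (q * w x + q * sum (map w xs))
    ≡⟨ ^-distribˡ-+-* t (q * w x) _ ⟩
      t ^ (q * w x) * t ^ (q * sum (map w xs))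
    ≤⟨ *-mono-≤ (t^qw≤w^qw*t^qt q (w x) 1≤t) (crude-entropy-bound xs w q 1≤t) ⟩
      (w x ^ (q * w x) * t ^ (q * t)) * (P * t ^ (q * t * length xs))
    ≡⟨ interchange (w x ^ (q * w x)) (t ^ (q * t)) P (t ^ (q * t * length xs)) ⟩
      (w x ^ (q * w x) * P) * (t ^ (q * t) * t ^ (q * t * length xs))
    ≡⟨ cong ((w x ^ (q * w x) * P) *_) (sym (^-distribˡ-+-* t (q * t) _)) ⟩
      (w x ^ (q * w x) * P) * t ^ (q * t + q * t * length xs)
    ≡⟨ cong (λ e → (w x ^ (q * w x) * P) * t ^ e) (sym (*-suc (q * t) (length xs))) ⟩
      (w x ^ (q * w x) * P) * t ^ (q * t * suc (length xs))
    ∎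
    where
      open ≤-Reasoning
      P = product (map (λ y → w y ^ (q * w y)) xs)
      interchange : ∀ a b c d → (a * b) * (c * d) ≡ (a * c) * (b * d)
      interchange = solve-∀

  ^-exchange-≤ : ∀ b .{{_ : NonZero b}} {P x y e f} → b ^ x ≤ P * b ^ y → e + y ≤ f + x → b ^ e ≤ b ^ f * P
  ^-exchange-≤ b {P} {x} {y} {e} {f} bˣ≤Pbʸ e+y≤f+x = *-cancelʳ-≤ (b ^ e) (b ^ f * P) (b ^ y) {{m^n≢0 b y}} (begin
      b ^ e * b ^ y
    ≡⟨ sym (^-distribˡ-+-* b e y) ⟩
      b ^ (e + y)
    ≤⟨ ^-monoʳ-≤ b e+y≤f+x ⟩
      b ^ (f + x)
    ≡⟨ ^-distribˡ-+-* b f x ⟩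
      b ^ f * b ^ x
    ≤⟨ *-monoʳ-≤ (b ^ f) bˣ≤Pbʸ ⟩
      b ^ f * (P * b ^ y)
    ≡⟨ sym (*-assoc (b ^ f) P _) ⟩
      b ^ f * P * b ^ y
    ∎)
    where open ≤-Reasoning

  module _ (q p a c t d : ℕ) (8q≤d : 8 * q ≤ d) (8cq≤n : 8 * c * q ≤ a + c) (1≤p : 1 ≤ p) where

    private
      n = a + c
      m = t * d

    entropy-slack : 4 * c * q * m + 4 * a * q * t ≤ p * n * m
    entropy-slack = *-cancelˡ-≤ 2 (begin
        2 * (4 * c * q * m + 4 * a * q * t)
      ≡⟨ regroup c q a t d ⟩
        8 * c * q * m + a * (8 * q * t)
      ≤⟨ +-mono-≤ (*-monoˡ-≤ m 8cq≤n) (*-mono-≤ (m≤m+n a c) (*-monoˡ-≤ t 8q≤d)) ⟩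
        n * m + n * (d * t)
      ≡⟨ cong (λ k → n * m + k) (trans (cong (n *_) (*-comm d t)) (sym (+-identityʳ (n * m)))) ⟩
        2 * (n * m)
      ≤⟨ *-monoʳ-≤ 2 (m≤n*m (n * m) p {{>-nonZero 1≤p}}) ⟩
        2 * (p * (n * m))
      ≡⟨ cong (2 *_) (sym (*-assoc p n m)) ⟩
        2 * (p * n * m)
      ∎)
      where
        open ≤-Reasoning
        regroup : ∀ c q a t d → 2 * (4 * c * q * (t * d) + 4 * a * q * t) ≡ 8 * c * q * (t * d) + a * (8 * q * t)
        regroup = solve-∀

    entropy-exponent : ∀ M → (4 * q + p) * (n * m) ≤ 8 * (2 * q + p) * M →
      2 * n * q * (m * m) + a * (q * t * m) ≤ (2 * q + p) * (2 * m * M) + a * (q * (m * m))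
    entropy-exponent M large = *-cancelˡ-≤ 4 (begin
        4 * (2 * n * q * (m * m) + a * (q * t * m))
      ≡⟨ split q a c t d ⟩
        m * (4 * q * n * m + 4 * a * q * m) + m * (4 * c * q * m + 4 * a * q * t)
      ≤⟨ +-monoʳ-≤ (m * (4 * q * n * m + 4 * a * q * m)) (*-monoʳ-≤ m entropy-slack) ⟩
        m * (4 * q * n * m + 4 * a * q * m) + m * (p * n * m)
      ≡⟨ regroup q p a c t d ⟩
        m * ((4 * q + p) * (n * m)) + m * (4 * a * q * m)
      ≤⟨ +-monoˡ-≤ (m * (4 * a * q * m)) (*-monoʳ-≤ m large) ⟩
        m * (8 * (2 * q + p) * M) + m * (4 * a * q * m)
      ≡⟨ collect q p a t d M ⟩
        4 * ((2 * q + p) * (2 * m * M) + a * (q * (m * m)))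
      ∎)
      where
        open ≤-Reasoning
        split : ∀ q a c t d → 4 * (2 * (a + c) * q * ((t * d) * (t * d)) + a * (q * t * (t * d)))
          ≡ t * d * (4 * q * (a + c) * (t * d) + 4 * a * q * (t * d)) + t * d * (4 * c * q * (t * d) + 4 * a * q * t)
        split = solve-∀
        regroup : ∀ q p a c t d →
          t * d * (4 * q * (a + c) * (t * d) + 4 * a * q * (t * d)) + t * d * (p * (a + c) * (t * d))
          ≡ t * d * ((4 * q + p) * ((a + c) * (t * d))) + t * d * (4 * a * q * (t * d))
        regroup = solve-∀
        collect : ∀ q p a t d M → t * d * (8 * (2 * q + p) * M) + t * d * (4 * a * q * (t * d))
          ≡ 4 * ((2 * q + p) * (2 * (t * d) * M) + a * (q * ((t * d) * (t * d))))
        collect = solve-∀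

  -- boundary f ≥ (4 + δ)/(4 + 2δ) · n 2ⁿ/4, a constant fraction of its mean, for δ = p/q.
  LargeBoundary : (q p : ℕ) → ∀ n → BoolFun n → Set
  LargeBoundary q p n f = (4 * q + p) * (n * 2 ^ n) ≤ 8 * (2 * q + p) * boundary f

  entropyBound-of-largeBoundary : ∀ δ {n} a c (f : BoolFun n) → n ≡ a + c →
    8 * ↧ₙ δ ≤ 2 ^ c → 8 * c * ↧ₙ δ ≤ n → 1 ≤ ∣ ↥ δ ∣ →
    LargeBoundary (↧ₙ δ) ∣ ↥ δ ∣ n f → EntropyBound δ n f
  entropyBound-of-largeBoundary δ a c f refl 8q≤2ᶜ 8cq≤n 1≤p large =
    ^-exchange-≤ 2 {e = 2 * n * q * W} {f = (2 * q + p) * T} weighted-bound (begin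
        2 * n * q * W + a * (q * t * length V)
      ≡⟨ cong₂ (λ W′ l → 2 * n * q * W′ + a * (q * t * l)) W≡m² (trans (length-allVecs n) 2ⁿ≡td) ⟩
        2 * n * q * (m * m) + a * (q * t * m)
      ≤⟨ entropy-exponent q p a c t d 8q≤2ᶜ 8cq≤n 1≤p (boundary f)
           (subst (λ k → (4 * q + p) * (n * k) ≤ 8 * (2 * q + p) * boundary f) 2ⁿ≡td large) ⟩
        (2 * q + p) * (2 * m * boundary f) + a * (q * (m * m))
      ≡⟨ cong₂ (λ T′ W′ → (2 * q + p) * T′ + a * (q * W′))
               (sym (trans (sum-wt*card f) (cong (λ k → 2 * k * boundary f) 2ⁿ≡td))) (sym W≡m²) ⟩
        (2 * q + p) * T + a * (q * W)
      ∎)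
    where
      open ≤-Reasoning
      n = a + c
      q = ↧ₙ δ
      p = ∣ ↥ δ ∣
      t = 2 ^ a
      d = 2 ^ c
      m = t * d
      V = allVecs n
      W = sum (map (wt f) V)
      T = sum (map (λ S → wt f S * card S) V)
      2ⁿ≡td : 2 ^ n ≡ m
      2ⁿ≡td = ^-distribˡ-+-* 2 a c
      W≡m² : W ≡ m * m
      W≡m² = trans (sum-wt f) (cong₂ _*_ 2ⁿ≡td 2ⁿ≡td)
      weighted-bound : 2 ^ (a * (q * W)) ≤ product (map (λ S → wt f S ^ (q * wt f S)) V) * 2 ^ (a * (q * t * length V))
      weighted-bound = subst₂ (λ u v → u ≤ product (map (λ S → wt f S ^ (q * wt f S)) V) * v)
                              (^-*-assoc 2 a (q * W)) (^-*-assoc 2 a (q * t * length V))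
                              (crude-entropy-bound V (wt f) q (m^n>0 2 a))

  -- Chebyshev's inequality

  markov : {A : Set} (xs : List A) {P : A → Set} (P? : Decidable P) (g : A → ℕ) (c : ℕ) →
    (∀ x → P x → c ≤ g x) → length (filter P? xs) * c ≤ sum (map g xs)
  markov []       P? g c c≤g = z≤n
  markov (x ∷ xs) P? g c c≤g with P? x
  ... | yes px = +-mono-≤ (c≤g x px) (markov xs P? g c c≤g)
  ... | no  _  = ≤-trans (markov xs P? g c c≤g) (m≤n+m _ (g x))

  m<∣+o-+n∣ : ∀ {m n o} → m + n < o → m < ∣ + o ℤ.- + n ∣
  m<∣+o-+n∣ {m} {n} {o} m+n<o =
    subst (m <_) (cong ∣_∣ (sym (trans (ℤP.[+m]-[+n]≡m⊖n o n) (ℤP.⊖-≥ (m+n≤o⇒n≤o m (<⇒≤ m+n<o))))))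
          (m+n≤o⇒m≤o∸n (suc m) m+n<o)

  largeDeviation : ∀ q p {n} (f : BoolFun n) → ¬ LargeBoundary q p n f →
    p * (n * 2 ^ n) < ∣ + (2 * (2 * q + p)) ℤ.* deviation n f ∣
  largeDeviation q p {n} f small = subst (λ z → p * (n * 2 ^ n) < ∣ z ∣) scaled (m<∣+o-+n∣ (begin-strict
      p * (n * 2 ^ n) + 2 * s * (4 * M)
    ≡⟨ cong (_+_ (p * (n * 2 ^ n))) (regroup s M) ⟩
      p * (n * 2 ^ n) + 8 * s * M
    <⟨ +-monoʳ-< (p * (n * 2 ^ n)) (≰⇒> small) ⟩
      p * (n * 2 ^ n) + (4 * q + p) * (n * 2 ^ n)
    ≡⟨ collect q p (n * 2 ^ n) ⟩
      2 * s * (n * 2 ^ n)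
    ∎))
    where
      open ≤-Reasoning
      s = 2 * q + p
      M = boundary f
      regroup : ∀ s M → 2 * s * (4 * M) ≡ 8 * s * M
      regroup = solve-∀
      collect : ∀ q p k → p * k + (4 * q + p) * k ≡ 2 * (2 * q + p) * k
      collect = solve-∀
      factor : ∀ a b c → a ℤ.* b ℤ.- a ℤ.* c ≡ a ℤ.* (b ℤ.- c)
      factor = ℤSolver.solve-∀
      scaled : + (2 * s * (n * 2 ^ n)) ℤ.- + (2 * s * (4 * M)) ≡ + (2 * s) ℤ.* deviation n f
      scaled = trans (cong₂ ℤ._-_ (trans (ℤP.pos-* (2 * s) (n * 2 ^ n))
                                          (cong (+ (2 * s) ℤ.*_) (trans (ℤP.pos-* n (2 ^ n))
                                                                        (cong (+ n ℤ.*_) (pos-^ 2 n)))))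
                                   (trans (ℤP.pos-* (2 * s) (4 * M)) (cong (+ (2 * s) ℤ.*_) (ℤP.pos-* 4 M))))
                     (factor (+ (2 * s)) _ _)

  sum-scaledDeviation² : ∀ k n →
    sum (map (λ f → ∣ + k ℤ.* deviation n f ∣ * ∣ + k ℤ.* deviation n f ∣) (allFuns n))
      ≡ k * k * (2 * length (allFuns n) * n * 2 ^ n)
  sum-scaledDeviation² k n = ℤP.+-injective (begin
      + sum (map (λ f → ∣ + k ℤ.* deviation n f ∣ * ∣ + k ℤ.* deviation n f ∣) L)
    ≡⟨ pos-sum L _ ⟩
      (∑[ f ∈ L ] + (∣ + k ℤ.* deviation n f ∣ * ∣ + k ℤ.* deviation n f ∣))
    ≡⟨ ∑-cong L (λ f → trans (pos-∣i∣*∣i∣ (+ k ℤ.* deviation n f)) (square-* (+ k) (deviation n f))) ⟩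
      (∑[ f ∈ L ] (+ k ℤ.* + k) ℤ.* deviation n f ²)
    ≡⟨ ∑-*ˡ L (+ k ℤ.* + k) (λ f → deviation n f ²) ⟩
      (+ k ℤ.* + k) ℤ.* (∑[ f ∈ L ] deviation n f ²)
    ≡⟨ cong ((+ k ℤ.* + k) ℤ.*_) (∑-deviation² n) ⟩
      (+ k ℤ.* + k) ℤ.* (+ 2 ℤ.* + length L ℤ.* + n ℤ.* (+ 2) ℤ.^ n)
    ≡⟨ sym (trans (ℤP.pos-* (k * k) _) (cong₂ ℤ._*_ (ℤP.pos-* k k) casts)) ⟩
      + (k * k * (2 * length L * n * 2 ^ n))
    ∎)
    where
      open ≡-Reasoning
      L = allFuns n
      square-* : ∀ a b → (a ℤ.* b) ℤ.* (a ℤ.* b) ≡ (a ℤ.* a) ℤ.* (b ℤ.* b)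
      square-* = ℤSolver.solve-∀
      casts : + (2 * length L * n * 2 ^ n) ≡ + 2 ℤ.* + length L ℤ.* + n ℤ.* (+ 2) ℤ.^ n
      casts = trans (ℤP.pos-* (2 * length L * n) (2 ^ n))
                    (cong₂ ℤ._*_ (trans (ℤP.pos-* (2 * length L) n) (cong (ℤ._* + n) (ℤP.pos-* 2 (length L))))
                                 (pos-^ 2 n))

  n≤2^n : ∀ n → n ≤ 2 ^ n
  n≤2^n zero    = z≤n
  n≤2^n (suc n) = +-mono-≤ (m^n>0 2 n) (≤-trans (n≤2^n n) (≤-reflexive (sym (+-identityʳ (2 ^ n)))))

  0<δ⇒1≤∣↥δ∣ : ∀ δ → 0ℚ ℚ.< δ → 1 ≤ ∣ ↥ δ ∣
  0<δ⇒1≤∣↥δ∣ (mkℚ (+ suc n) _ _) _                   = s≤s z≤n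
  0<δ⇒1≤∣↥δ∣ (mkℚ (+ zero)  _ _) (ℚ.*<* (ℤ.+<+ ()))
  0<δ⇒1≤∣↥δ∣ (mkℚ -[1+ n ]  _ _) (ℚ.*<* ())

  badCount-chebyshev : ∀ δ → 0ℚ ℚ.< δ → ∀ n → 8 * (3 + ↧ₙ δ) * ↧ₙ δ ≤ n →
    let q = ↧ₙ δ; p = ∣ ↥ δ ∣; S = 2 * (2 * q + p) in
    badCount δ n * (p * (n * 2 ^ n) * (p * (n * 2 ^ n))) ≤ S * S * (2 * length (allFuns n) * n * 2 ^ n)
  badCount-chebyshev δ 0<δ n 8cq≤n =
    subst (badCount δ n * (p * (n * 2 ^ n) * (p * (n * 2 ^ n))) ≤_) (sum-scaledDeviation² S n)
          (markov (allFuns n) (λ f → ¬? (entropyBound? δ n f)) g _ bad⇒deviant)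
    where
      q = ↧ₙ δ
      p = ∣ ↥ δ ∣
      S = 2 * (2 * q + p)
      c = 3 + q
      g : BoolFun n → ℕ
      g f = ∣ + S ℤ.* deviation n f ∣ * ∣ + S ℤ.* deviation n f ∣
      c≤n : c ≤ n
      c≤n = ≤-trans (m≤m*n c q) (≤-trans (m≤n*m (c * q) 8) (≤-trans (≤-reflexive (sym (*-assoc 8 c q))) 8cq≤n))
      8q≤2ᶜ : 8 * q ≤ 2 ^ c
      8q≤2ᶜ = subst (8 * q ≤_) (regroup (2 ^ q)) (*-monoʳ-≤ 8 (n≤2^n q))
        where
          regroup : ∀ x → 8 * x ≡ 2 * (2 * (2 * x))
          regroup = solve-∀
      bad⇒deviant : ∀ f → ¬ EntropyBound δ n f → p * (n * 2 ^ n) * (p * (n * 2 ^ n)) ≤ g f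
      bad⇒deviant f ¬bound with (4 * q + p) * (n * 2 ^ n) ≤? 8 * (2 * q + p) * boundary f
      ... | yes large = ⊥-elim (¬bound (entropyBound-of-largeBoundary δ (n ∸ c) c f (sym (m∸n+n≡m c≤n))
                                          8q≤2ᶜ 8cq≤n (0<δ⇒1≤∣↥δ∣ δ 0<δ) large))
      ... | no  small = *-mono-≤ (<⇒≤ deviant) (<⇒≤ deviant)
        where deviant = largeDeviation q p f small

  chebyshev-count : ∀ k b N p n m S → 1 ≤ p → 1 ≤ n → 1 ≤ m → 2 * k * (S * S) ≤ n →
    b * (p * (n * m) * (p * (n * m))) ≤ S * S * (2 * N * n * m) → k * b ≤ N
  chebyshev-count k b N p@(suc _) n@(suc _) m@(suc _) S _ _ _ 2kS²≤n b-bound =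
    *-cancelʳ-≤ (k * b) N (x * x) (begin
      k * b * (x * x)
    ≡⟨ *-assoc k b (x * x) ⟩
      k * (b * (x * x))
    ≤⟨ *-monoʳ-≤ k b-bound ⟩
      k * (S * S * (2 * N * n * m))
    ≡⟨ regroup k S N n m ⟩
      2 * k * (S * S) * (N * (n * m))
    ≤⟨ *-monoˡ-≤ (N * (n * m)) 2kS²≤n ⟩
      n * (N * (n * m))
    ≡⟨ x*[y*z]≡y*[x*z] n N (n * m) ⟩
      N * (n * (n * m))
    ≤⟨ *-monoʳ-≤ N (*-mono-≤ (≤-trans (m≤m*n n m) (m≤n*m (n * m) p)) (m≤n*m (n * m) p)) ⟩
      N * (x * x)
    ∎)
    where
      open ≤-Reasoning
      x = p * (n * m)
      regroup : ∀ k S N n m → k * (S * S * (2 * N * n * m)) ≡ 2 * k * (S * S) * (N * (n * m))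
      regroup = solve-∀
      x*[y*z]≡y*[x*z] : ∀ x y z → x * (y * z) ≡ y * (x * z)
      x*[y*z]≡y*[x*z] = solve-∀

open import Data.Nat using (ℕ; suc; _+_; _*_; _^_; _≤_; z≤n; s≤s)
open import Data.Nat.Properties using (≤-trans; m≤m+n; m≤n+m; n≤1+n; m^n>0)
open import Data.Integer using (∣_∣)
open import Data.Product using (∃-syntax)
open import Data.Rational using (ℚ; 0ℚ; _<_; ↥_; ↧ₙ_)

theorem1 : (δ : ℚ) → 0ℚ < δ → (k : ℕ) →
    ∃[ N ] ((n : ℕ) → N ≤ n → k * badCount δ n ≤ length (allFuns n))
theorem1 δ 0<δ k = N₀ , λ n N₀≤n →
    chebyshev-count k (badCount δ n) (length (allFuns n)) p n (2 ^ n) S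
      (0<δ⇒1≤∣↥δ∣ δ 0<δ) (≤-trans (s≤s z≤n) N₀≤n) (m^n>0 2 n)
      (≤-trans (m≤n+m _ _) (large n N₀≤n))
      (badCount-chebyshev δ 0<δ n (≤-trans (m≤m+n _ _) (large n N₀≤n)))
  where
    q = ↧ₙ δ
    p = ∣ ↥ δ ∣
    S = 2 * (2 * q + p)
    N₀ = suc (8 * (3 + q) * q + 2 * k * (S * S))
    large : ∀ n → N₀ ≤ n → 8 * (3 + q) * q + 2 * k * (S * S) ≤ n
    large n N₀≤n = ≤-trans (n≤1+n _) N₀≤n
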